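{- Let $\sigma\in I_{n,k}$ with $\sigma^0\neq\emptyset$, let $f=\max\sigma^0$ and let $\widehat\sigma=\sigma(f,n+1)\in I_{n+1,k+1}$ be its $(0,1)$-maximal completion. Then for every predecessor $\sigma'$ of $\sigma$ there exists a fixed point $g$ of $\sigma'$ such that $\sigma'(g,n+1)$ is a predecessor of $\widehat\sigma$.
   Context: $I_{N,K}$: involutions of $\{1,\dots,N\}$ with exactly $K$ disjoint 2-cycles, identified with link patterns (arcs $(a,b)$, $a<b=\sigma(a)$); $\sigma^0$ = fixed points; $\sigma\in I_{n,k}$ is also regarded as a link pattern on $n+1$ points with $n+1$ fixed. $\sigma^-_{\dots}$ deletes the listed arcs and $\sigma(a,b)$ adds the arc $(a,b)$ between fixed points $a<b$. A predecessor of $\omega$ is a link pattern obtained by an elementary move forward: for $(i,j)\in\omega$ and $f'\in\omega^0$ with $i<f'<j$, either $(i,f')\omega^-_{(i,j)}$ or $(f',j)\omega^-_{(i,j)}$; or, for $(i,j),(l,m)\in\omega$ with $i<l<j<m$, either $(i,l)(j,m)\omega^-_{(i,j),(l,m)}$ or $(i,m)(j,l)\omega^-_{(i,j),(l,m)}$. -}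

module Defs where

open import Data.Nat using (ℕ; suc)
open import Data.Fin using (Fin; _<_; _≤_; _≟_; inject₁; fromℕ; toℕ)
open import Data.List using (length; filter)
open import Data.List.Base using (allFin)
open import Data.Product using (_×_)
open import Relation.Nullary using (yes; no)
open import Relation.Binary.PropositionalEquality using (_≡_; _≗_)

-- A (partial) link pattern / involution on the N points 0,…,N-1
-- (the paper's points 1,…,N), given as a map.
LP : ℕ → Set
LP N = Fin N → Fin N

IsInvolution : ∀ {N} → LP N → Set
IsInvolution σ = ∀ x → σ (σ x) ≡ x

numArcs : ∀ {N} → LP N → ℕ
numArcs {N} σ = length (filter (λ x → toℕ x Data.Nat.<? toℕ (σ x)) (allFin N))

InI : (N K : ℕ) → LP N → Set
InI N K σ = IsInvolution σ × numArcs σ ≡ K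

Arc : ∀ {N} → LP N → Fin N → Fin N → Set
Arc σ a b = (a < b) × (σ a ≡ b)

Fixed : ∀ {N} → LP N → Fin N → Set
Fixed σ a = σ a ≡ a

addArc : ∀ {N} → Fin N → Fin N → LP N → LP N
addArc a b σ x with x ≟ a
... | yes _ = b
... | no _ with x ≟ b
...   | yes _ = a
...   | no _ = σ x

delArc : ∀ {N} → Fin N → Fin N → LP N → LP N
delArc a b σ x with x ≟ a
... | yes _ = a
... | no _ with x ≟ b
...   | yes _ = b
...   | no _ = σ x

extend : ∀ {n} → LP n → LP (suc n)
extend {n} σ x with Data.Fin.toℕ x Data.Nat.<? n
... | yes x<n = inject₁ (σ (Data.Fin.fromℕ< x<n))
... | no _ = x

lastPt : ∀ n → Fin (suc n)
lastPt n = fromℕ n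

data Pred {N : ℕ} (ω : LP N) : LP N → Set where
  left  : ∀ {ω'} i j f' → Arc ω i j → Fixed ω f' → i < f' → f' < j →
          ω' ≗ addArc i f' (delArc i j ω) → Pred ω ω'
  right : ∀ {ω'} i j f' → Arc ω i j → Fixed ω f' → i < f' → f' < j →
          ω' ≗ addArc f' j (delArc i j ω) → Pred ω ω'
  cross-nest : ∀ {ω'} i j l m → Arc ω i j → Arc ω l m → i < l → l < j → j < m →
          ω' ≗ addArc i l (addArc j m (delArc l m (delArc i j ω))) → Pred ω ω'
  cross-par  : ∀ {ω'} i j l m → Arc ω i j → Arc ω l m → i < l → l < j → j < m →
          ω' ≗ addArc i m (addArc j l (delArc l m (delArc i j ω))) → Pred ω ω'

IsMaxFixed : ∀ {N} → LP N → Fin N → Set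
IsMaxFixed σ f = Fixed σ f × (∀ x → Fixed σ x → x ≤ f)

module Submission where

-- An elementary move rewrites a link pattern by a short word of arc
-- operations (delete one or two arcs, add one or two arcs).  The completion
-- σ ↦ complete f σ = σ(f, n+1) is itself an arc addition on the extended
-- pattern, and it commutes with every arc operation whose endpoints avoid f.
-- Since f is a fixed point of σ it is an endpoint of no arc of σ, so:
--   * if the move does not use f, the same move performed on σ̂ gives the
--     completion of σ' at g = f (lemma move-completes);
--   * if the move joins an arc (i,j) to f, we take g = j (resp. g = i): then
--     the completion of σ' is obtained from σ̂ by the crossing move on the
--     arcs (i,j) and (f,n+1) (lemmas left-into-f, right-into-f).

open import Defs
open import Data.Nat using (ℕ; suc)
open import Data.Fin using (Fin; inject₁)
open import Data.Product using (Σ; _×_)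

import Data.Nat as ℕ
open import Data.Nat.Properties using (<-irrefl)
open import Data.Fin using (toℕ; fromℕ; lower₁; _≟_; _<_)
open import Data.Fin.Properties
  using (toℕ-injective; toℕ-fromℕ; toℕ-fromℕ<; toℕ-inject₁; toℕ<n; inject₁-lower₁; inject₁-injective; fromℕ≢inject₁; <⇒≢)
open import Data.List using (List; []; _∷_; foldr; map)
open import Data.List.Relation.Unary.All using (All; []; _∷_)
open import Data.Product using (_,_; proj₁; proj₂)
open import Data.Sum using (_⊎_; inj₁; inj₂)
open import Data.Empty using (⊥-elim)
open import Relation.Nullary using (yes; no)
open import Relation.Binary.PropositionalEquality
import Relation.Binary.Reasoning.Setoid as SetoidReasoning

module ≗-Reasoning (N : ℕ) = SetoidReasoning (Fin N →-setoid Fin N)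

module _ {N : ℕ} where

  addArc-fst : ∀ (a b : Fin N) τ → addArc a b τ a ≡ b
  addArc-fst a b τ with a ≟ a
  ... | yes _ = refl
  ... | no a≢a = ⊥-elim (a≢a refl)

  addArc-snd : ∀ (a b : Fin N) τ → addArc a b τ b ≡ a
  addArc-snd a b τ with b ≟ a
  ... | yes b≡a = b≡a
  ... | no _ with b ≟ b
  ...   | yes _ = refl
  ...   | no b≢b = ⊥-elim (b≢b refl)

  addArc-at : ∀ (a b : Fin N) {τ τ′} x → τ x ≡ τ′ x → addArc a b τ x ≡ addArc a b τ′ x
  addArc-at a b x e with x ≟ a
  ... | yes _ = refl
  ... | no _ with x ≟ b
  ...   | yes _ = refl
  ...   | no _ = e

  addArc-other : ∀ {a b x : Fin N} {τ} → x ≢ a → x ≢ b → addArc a b τ x ≡ τ x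
  addArc-other {a} {b} {x} x≢a x≢b with x ≟ a
  ... | yes x≡a = ⊥-elim (x≢a x≡a)
  ... | no _ with x ≟ b
  ...   | yes x≡b = ⊥-elim (x≢b x≡b)
  ...   | no _ = refl

  delArc-fst : ∀ (a b : Fin N) τ → delArc a b τ a ≡ a
  delArc-fst a b τ with a ≟ a
  ... | yes _ = refl
  ... | no a≢a = ⊥-elim (a≢a refl)

  delArc-snd : ∀ (a b : Fin N) τ → delArc a b τ b ≡ b
  delArc-snd a b τ with b ≟ a
  ... | yes b≡a = sym b≡a
  ... | no _ with b ≟ b
  ...   | yes _ = refl
  ...   | no b≢b = ⊥-elim (b≢b refl)

  delArc-at : ∀ (a b : Fin N) {τ τ′} x → τ x ≡ τ′ x → delArc a b τ x ≡ delArc a b τ′ x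
  delArc-at a b x e with x ≟ a
  ... | yes _ = refl
  ... | no _ with x ≟ b
  ...   | yes _ = refl
  ...   | no _ = e

  delArc-other : ∀ {a b x : Fin N} {τ} → x ≢ a → x ≢ b → delArc a b τ x ≡ τ x
  delArc-other {a} {b} {x} x≢a x≢b with x ≟ a
  ... | yes x≡a = ⊥-elim (x≢a x≡a)
  ... | no _ with x ≟ b
  ...   | yes x≡b = ⊥-elim (x≢b x≡b)
  ...   | no _ = refl

  addArc-cong : ∀ (a b : Fin N) {τ τ′} → τ ≗ τ′ → addArc a b τ ≗ addArc a b τ′
  addArc-cong a b e x = addArc-at a b x (e x)

  delArc-cong : ∀ (a b : Fin N) {τ τ′} → τ ≗ τ′ → delArc a b τ ≗ delArc a b τ′
  delArc-cong a b e x = delArc-at a b x (e x)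

  ≗-by-cases : ∀ (a b : Fin N) {ρ ρ′ : LP N} → ρ a ≡ ρ′ a → ρ b ≡ ρ′ b →
               (∀ x → x ≢ a → x ≢ b → ρ x ≡ ρ′ x) → ρ ≗ ρ′
  ≗-by-cases a b at-a at-b away x with x ≟ a | x ≟ b
  ... | yes refl | _ = at-a
  ... | no _ | yes refl = at-b
  ... | no x≢a | no x≢b = away x x≢a x≢b

  addArc-swap : ∀ (a b : Fin N) τ → addArc a b τ ≗ addArc b a τ
  addArc-swap a b τ = ≗-by-cases a b
    (trans (addArc-fst a b τ) (sym (addArc-snd b a τ)))
    (trans (addArc-snd a b τ) (sym (addArc-fst b a τ)))
    (λ x x≢a x≢b → trans (addArc-other x≢a x≢b) (sym (addArc-other x≢b x≢a)))

  delArc-addArc : ∀ (a b : Fin N) τ → τ a ≡ a → τ b ≡ b → delArc a b (addArc a b τ) ≗ τ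
  delArc-addArc a b τ τa≡a τb≡b = ≗-by-cases a b
    (trans (delArc-fst a b _) (sym τa≡a))
    (trans (delArc-snd a b _) (sym τb≡b))
    (λ x x≢a x≢b → trans (delArc-other x≢a x≢b) (addArc-other x≢a x≢b))

  addArc-addArc-comm : ∀ (a b c d : Fin N) τ → c ≢ a → c ≢ b → d ≢ a → d ≢ b →
                       addArc a b (addArc c d τ) ≗ addArc c d (addArc a b τ)
  addArc-addArc-comm a b c d τ c≢a c≢b d≢a d≢b = ≗-by-cases a b
    (trans (addArc-fst a b _) (sym (trans (addArc-other (≢-sym c≢a) (≢-sym d≢a)) (addArc-fst a b τ))))
    (trans (addArc-snd a b _) (sym (trans (addArc-other (≢-sym c≢b) (≢-sym d≢b)) (addArc-snd a b τ))))
    (λ x x≢a x≢b → trans (addArc-other x≢a x≢b) (addArc-at c d {τ} x (sym (addArc-other x≢a x≢b))))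

  delArc-addArc-comm : ∀ (a b c d : Fin N) τ → c ≢ a → c ≢ b → d ≢ a → d ≢ b →
                       delArc a b (addArc c d τ) ≗ addArc c d (delArc a b τ)
  delArc-addArc-comm a b c d τ c≢a c≢b d≢a d≢b = ≗-by-cases a b
    (trans (delArc-fst a b _) (sym (trans (addArc-other (≢-sym c≢a) (≢-sym d≢a)) (delArc-fst a b τ))))
    (trans (delArc-snd a b _) (sym (trans (addArc-other (≢-sym c≢b) (≢-sym d≢b)) (delArc-snd a b τ))))
    (λ x x≢a x≢b → trans (delArc-other x≢a x≢b) (addArc-at c d {τ} x (sym (delArc-other x≢a x≢b))))

module _ {n : ℕ} where

  ι : Fin n → Fin (suc n)
  ι = inject₁

  ℓ : Fin (suc n)
  ℓ = lastPt n

  ι-≢ : ∀ {a b : Fin n} → a ≢ b → ι a ≢ ι b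
  ι-≢ a≢b ιa≡ιb = a≢b (inject₁-injective ιa≡ιb)

  ℓ≢ι : ∀ {a : Fin n} → ℓ ≢ ι a
  ℓ≢ι = fromℕ≢inject₁

  ι-mono : ∀ {a b : Fin n} → a < b → ι a < ι b
  ι-mono {a} {b} = subst₂ ℕ._<_ (sym (toℕ-inject₁ a)) (sym (toℕ-inject₁ b))

  ι<ℓ : ∀ (a : Fin n) → ι a < ℓ
  ι<ℓ a = subst₂ ℕ._<_ (sym (toℕ-inject₁ a)) (sym (toℕ-fromℕ n)) (toℕ<n a)

  ℓ-or-ι : ∀ (x : Fin (suc n)) → x ≡ ℓ ⊎ Σ (Fin n) (λ y → x ≡ ι y)
  ℓ-or-ι x with n ℕ.≟ toℕ x
  ... | yes n≡x = inj₁ (toℕ-injective (trans (sym n≡x) (sym (toℕ-fromℕ n))))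
  ... | no n≢x = inj₂ (lower₁ x n≢x , sym (inject₁-lower₁ x n≢x))

  extend-ι : ∀ (τ : LP n) x → extend τ (ι x) ≡ ι (τ x)
  extend-ι τ x with toℕ (inject₁ x) ℕ.<? n
  ... | yes x<n = cong (λ y → ι (τ y)) (toℕ-injective (trans (toℕ-fromℕ< x<n) (toℕ-inject₁ x)))
  ... | no x≮n = ⊥-elim (x≮n (subst (ℕ._< n) (sym (toℕ-inject₁ x)) (toℕ<n x)))

  extend-ℓ : ∀ (τ : LP n) → extend τ ℓ ≡ ℓ
  extend-ℓ τ with toℕ (fromℕ n) ℕ.<? n
  ... | yes n<n = ⊥-elim (<-irrefl (toℕ-fromℕ n) n<n)
  ... | no _ = refl

  extend-unique : ∀ {τ : LP n} {ρ : LP (suc n)} →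
                  (∀ x → ρ (ι x) ≡ ι (τ x)) → ρ ℓ ≡ ℓ → extend τ ≗ ρ
  extend-unique {τ} on-ι on-ℓ x with ℓ-or-ι x
  ... | inj₁ refl = trans (extend-ℓ τ) (sym on-ℓ)
  ... | inj₂ (y , refl) = trans (extend-ι τ y) (sym (on-ι y))

  extend-cong : ∀ {τ τ′ : LP n} → τ ≗ τ′ → extend τ ≗ extend τ′
  extend-cong {τ′ = τ′} e =
    extend-unique (λ x → trans (extend-ι τ′ x) (cong ι (sym (e x)))) (extend-ℓ τ′)

  addArc-ι : ∀ (a b : Fin n) {τ ρ} → (∀ x → ρ (ι x) ≡ ι (τ x)) →
             ∀ x → addArc (ι a) (ι b) ρ (ι x) ≡ ι (addArc a b τ x)
  addArc-ι a b on-ι x with x ≟ a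
  ... | yes refl = addArc-fst (ι x) (ι b) _
  ... | no x≢a with x ≟ b
  ...   | yes refl = addArc-snd (ι a) (ι x) _
  ...   | no x≢b = trans (addArc-other (ι-≢ x≢a) (ι-≢ x≢b)) (on-ι x)

  delArc-ι : ∀ (a b : Fin n) {τ ρ} → (∀ x → ρ (ι x) ≡ ι (τ x)) →
             ∀ x → delArc (ι a) (ι b) ρ (ι x) ≡ ι (delArc a b τ x)
  delArc-ι a b on-ι x with x ≟ a
  ... | yes refl = delArc-fst (ι x) (ι b) _
  ... | no x≢a with x ≟ b
  ...   | yes refl = delArc-snd (ι a) (ι x) _
  ...   | no x≢b = trans (delArc-other (ι-≢ x≢a) (ι-≢ x≢b)) (on-ι x)

  extend-addArc : ∀ (a b : Fin n) τ → extend (addArc a b τ) ≗ addArc (ι a) (ι b) (extend τ)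
  extend-addArc a b τ =
    extend-unique (addArc-ι a b (extend-ι τ)) (trans (addArc-other ℓ≢ι ℓ≢ι) (extend-ℓ τ))

  extend-delArc : ∀ (a b : Fin n) τ → extend (delArc a b τ) ≗ delArc (ι a) (ι b) (extend τ)
  extend-delArc a b τ =
    extend-unique (delArc-ι a b (extend-ι τ)) (trans (delArc-other ℓ≢ι ℓ≢ι) (extend-ℓ τ))

data ArcOp (N : ℕ) : Set where
  add del : Fin N → Fin N → ArcOp N

module _ {N : ℕ} where

  run : ArcOp N → LP N → LP N
  run (add a b) = addArc a b
  run (del a b) = delArc a b

  -- runAll (o₁ ∷ … ∷ oₖ ∷ []) τ performs oₖ first and o₁ last.
  runAll : List (ArcOp N) → LP N → LP N
  runAll ops τ = foldr run τ ops

  Avoids : Fin N → ArcOp N → Set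
  Avoids x (add a b) = x ≢ a × x ≢ b
  Avoids x (del a b) = x ≢ a × x ≢ b

  run-cong : ∀ o {τ τ′ : LP N} → τ ≗ τ′ → run o τ ≗ run o τ′
  run-cong (add a b) = addArc-cong a b
  run-cong (del a b) = delArc-cong a b

  runAll-fixes : ∀ {x : Fin N} {ops τ} → All (Avoids x) ops → τ x ≡ x → runAll ops τ x ≡ x
  runAll-fixes [] τx≡x = τx≡x
  runAll-fixes {ops = add a b ∷ _} ((x≢a , x≢b) ∷ avs) τx≡x =
    trans (addArc-other x≢a x≢b) (runAll-fixes avs τx≡x)
  runAll-fixes {ops = del a b ∷ _} ((x≢a , x≢b) ∷ avs) τx≡x =
    trans (delArc-other x≢a x≢b) (runAll-fixes avs τx≡x)

  run-addArc-comm : ∀ o (c d : Fin N) τ → Avoids c o → Avoids d o →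
                    run o (addArc c d τ) ≗ addArc c d (run o τ)
  run-addArc-comm (add a b) c d τ (c≢a , c≢b) (d≢a , d≢b) = addArc-addArc-comm a b c d τ c≢a c≢b d≢a d≢b
  run-addArc-comm (del a b) c d τ (c≢a , c≢b) (d≢a , d≢b) = delArc-addArc-comm a b c d τ c≢a c≢b d≢a d≢b

module _ {n : ℕ} where

  lift : ArcOp n → ArcOp (suc n)
  lift (add a b) = add (ι a) (ι b)
  lift (del a b) = del (ι a) (ι b)

  lift-avoids : ∀ {g : Fin n} o → Avoids g o → Avoids (ι g) (lift o)
  lift-avoids (add a b) (g≢a , g≢b) = ι-≢ g≢a , ι-≢ g≢b
  lift-avoids (del a b) (g≢a , g≢b) = ι-≢ g≢a , ι-≢ g≢b

  ℓ-avoids : ∀ (o : ArcOp n) → Avoids ℓ (lift o)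
  ℓ-avoids (add a b) = ℓ≢ι , ℓ≢ι
  ℓ-avoids (del a b) = ℓ≢ι , ℓ≢ι

  extend-run : ∀ o (τ : LP n) → extend (run o τ) ≗ run (lift o) (extend τ)
  extend-run (add a b) = extend-addArc a b
  extend-run (del a b) = extend-delArc a b

  complete : Fin n → LP n → LP (suc n)
  complete g τ = addArc (ι g) ℓ (extend τ)

  complete-cong : ∀ g {τ τ′ : LP n} → τ ≗ τ′ → complete g τ ≗ complete g τ′
  complete-cong g e = addArc-cong (ι g) ℓ (extend-cong e)

  complete-run : ∀ {g} o (τ : LP n) → Avoids g o → complete g (run o τ) ≗ run (lift o) (complete g τ)
  complete-run {g} o τ g-avoids = begin
    addArc (ι g) ℓ (extend (run o τ))         ≈⟨ addArc-cong (ι g) ℓ (extend-run o τ) ⟩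
    addArc (ι g) ℓ (run (lift o) (extend τ))  ≈⟨ run-addArc-comm (lift o) (ι g) ℓ (extend τ) (lift-avoids o g-avoids) (ℓ-avoids o) ⟨
    run (lift o) (addArc (ι g) ℓ (extend τ))  ∎
    where open ≗-Reasoning (suc n)

  complete-runAll : ∀ {g} ops (τ : LP n) → All (Avoids g) ops →
                    complete g (runAll ops τ) ≗ runAll (map lift ops) (complete g τ)
  complete-runAll [] τ [] = λ _ → refl
  complete-runAll {g} (o ∷ ops) τ (av ∷ avs) = begin
    complete g (run o (runAll ops τ))                 ≈⟨ complete-run o (runAll ops τ) av ⟩
    run (lift o) (complete g (runAll ops τ))          ≈⟨ run-cong (lift o) (complete-runAll ops τ avs) ⟩
    run (lift o) (runAll (map lift ops) (complete g τ)) ∎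
    where open ≗-Reasoning (suc n)

  complete-new-arc : ∀ g (τ : LP n) → Arc (complete g τ) (ι g) ℓ
  complete-new-arc g τ = ι<ℓ g , addArc-fst (ι g) ℓ (extend τ)

  complete-arc : ∀ {g i j} {τ : LP n} → g ≢ i → Arc τ i j → Arc (complete g τ) (ι i) (ι j)
  complete-arc {τ = τ} g≢i (i<j , τi≡j) =
    ι-mono i<j , trans (addArc-other (ι-≢ (≢-sym g≢i)) (≢-sym ℓ≢ι)) (trans (extend-ι τ _) (cong ι τi≡j))

  complete-fixed : ∀ {g x} {τ : LP n} → x ≢ g → Fixed τ x → Fixed (complete g τ) (ι x)
  complete-fixed {τ = τ} x≢g τx≡x =
    trans (addArc-other (ι-≢ x≢g) (≢-sym ℓ≢ι)) (trans (extend-ι τ _) (cong ι τx≡x))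

  uncomplete : ∀ g (τ : LP n) → Fixed τ g → delArc (ι g) ℓ (complete g τ) ≗ extend τ
  uncomplete g τ τg≡g =
    delArc-addArc (ι g) ℓ (extend τ) (trans (extend-ι τ g) (cong ι τg≡g)) (extend-ℓ τ)

module _ {N : ℕ} {σ : LP N} where

  fixed-avoids-arc : IsInvolution σ → ∀ {f i j} → Fixed σ f → Arc σ i j → Avoids f (del i j)
  fixed-avoids-arc inv {f} {i} {j} σf≡f (i<j , σi≡j) = f≢i , f≢j
    where
    f≢i : f ≢ i
    f≢i refl = <⇒≢ i<j (trans (sym σf≡f) σi≡j)
    -- if f = j then i = σ j = j
    f≢j : f ≢ j
    f≢j refl = <⇒≢ i<j (trans (sym (trans (cong σ (sym σi≡j)) (inv i))) σf≡f)

module Completion {n : ℕ} (σ : LP n) (inv : IsInvolution σ) (f : Fin n) (σf≡f : Fixed σ f) where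

  σ̂ : LP (suc n)
  σ̂ = complete f σ

  Lifts : LP n → Set
  Lifts σ′ = Σ (Fin n) (λ g → Fixed σ′ g × Pred σ̂ (complete g σ′))

  avoids : ∀ {i j} → Arc σ i j → Avoids f (del i j)
  avoids = fixed-avoids-arc inv σf≡f

  arc-ends-differ : ∀ {i j} → Arc σ i j → i ≢ j
  arc-ends-differ (i<j , _) = <⇒≢ i<j

  σ̂-arc : ∀ {i j} → Arc σ i j → Arc σ̂ (ι i) (ι j)
  σ̂-arc a = complete-arc (proj₁ (avoids a)) a

  move-fixes-f : ∀ {σ′ ops} → σ′ ≗ runAll ops σ → All (Avoids f) ops → Fixed σ′ f
  move-fixes-f e avs = trans (e f) (runAll-fixes avs σf≡f)

  move-completes : ∀ {σ′} ops → σ′ ≗ runAll ops σ → All (Avoids f) ops →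
                   complete f σ′ ≗ runAll (map lift ops) σ̂
  move-completes ops e avs x = trans (complete-cong f e x) (complete-runAll ops σ avs x)

  reopen : ∀ {i j} → Arc σ i j →
           delArc (ι f) ℓ (delArc (ι i) (ι j) σ̂) ≗ extend (delArc i j σ)
  reopen {i} {j} a = begin
    delArc (ι f) ℓ (delArc (ι i) (ι j) σ̂)      ≈⟨ delArc-cong (ι f) ℓ (complete-run (del i j) σ (avoids a)) ⟨
    delArc (ι f) ℓ (complete f (delArc i j σ))  ≈⟨ uncomplete f (delArc i j σ) δf≡f ⟩
    extend (delArc i j σ)                        ∎
    where
    open ≗-Reasoning (suc n)
    δf≡f : delArc i j σ f ≡ f
    δf≡f = trans (delArc-other (proj₁ (avoids a)) (proj₂ (avoids a))) σf≡f

  -- The move (i,j) ↦ (i,f): take g = j and cross (i,j) with (f, n+1).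
  left-into-f : ∀ {σ′ i j} → Arc σ i j → i < f → f < j →
                σ′ ≗ addArc i f (delArc i j σ) → Lifts σ′
  left-into-f {σ′} {i} {j} a i<f f<j e =
    j , σ′j≡j , cross-nest (ι i) (ι j) (ι f) ℓ (σ̂-arc a) (complete-new-arc f σ) (ι-mono i<f) (ι-mono f<j) (ι<ℓ j) lifted
    where
    open ≗-Reasoning (suc n)
    j≢i : j ≢ i
    j≢i = ≢-sym (arc-ends-differ a)
    j≢f : j ≢ f
    j≢f = ≢-sym (proj₂ (avoids a))
    σ′j≡j : Fixed σ′ j
    σ′j≡j = trans (e j) (trans (addArc-other j≢i j≢f) (delArc-snd i j σ))
    lifted : complete j σ′ ≗ addArc (ι i) (ι f) (addArc (ι j) ℓ (delArc (ι f) ℓ (delArc (ι i) (ι j) σ̂)))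
    lifted = begin
      complete j σ′                                      ≈⟨ complete-cong j e ⟩
      complete j (addArc i f (delArc i j σ))              ≈⟨ complete-run (add i f) (delArc i j σ) (j≢i , j≢f) ⟩
      addArc (ι i) (ι f) (complete j (delArc i j σ))      ≈⟨ addArc-cong (ι i) (ι f) (addArc-cong (ι j) ℓ (reopen a)) ⟨
      addArc (ι i) (ι f) (addArc (ι j) ℓ (delArc (ι f) ℓ (delArc (ι i) (ι j) σ̂))) ∎

  -- The move (i,j) ↦ (f,j): take g = i and cross (i,j) with (f, n+1).
  right-into-f : ∀ {σ′ i j} → Arc σ i j → i < f → f < j →
                 σ′ ≗ addArc f j (delArc i j σ) → Lifts σ′
  right-into-f {σ′} {i} {j} a i<f f<j e =
    i , σ′i≡i , cross-par (ι i) (ι j) (ι f) ℓ (σ̂-arc a) (complete-new-arc f σ) (ι-mono i<f) (ι-mono f<j) (ι<ℓ j) lifted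
    where
    open ≗-Reasoning (suc n)
    σ′i≡i : Fixed σ′ i
    σ′i≡i = trans (e i) (trans (addArc-other (≢-sym (proj₁ (avoids a))) (arc-ends-differ a)) (delArc-fst i j σ))
    lifted : complete i σ′ ≗ addArc (ι i) ℓ (addArc (ι j) (ι f) (delArc (ι f) ℓ (delArc (ι i) (ι j) σ̂)))
    lifted = begin
      complete i σ′                                   ≈⟨ complete-cong i e ⟩
      complete i (addArc f j (delArc i j σ))           ≈⟨ complete-cong i (addArc-swap f j (delArc i j σ)) ⟩
      addArc (ι i) ℓ (extend (addArc j f (delArc i j σ)))  ≈⟨ addArc-cong (ι i) ℓ (extend-addArc j f (delArc i j σ)) ⟩
      addArc (ι i) ℓ (addArc (ι j) (ι f) (extend (delArc i j σ)))
        ≈⟨ addArc-cong (ι i) ℓ (addArc-cong (ι j) (ι f) (reopen a)) ⟨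
      addArc (ι i) ℓ (addArc (ι j) (ι f) (delArc (ι f) ℓ (delArc (ι i) (ι j) σ̂))) ∎

  predecessor-lifts : ∀ {σ′} → Pred σ σ′ → Lifts σ′
  predecessor-lifts (left i j f′ a σf′≡f′ i<f′ f′<j e) with f′ ≟ f
  ... | yes refl = left-into-f a i<f′ f′<j e
  ... | no f′≢f = f , move-fixes-f e avs ,
    left (ι i) (ι j) (ι f′) (σ̂-arc a) (complete-fixed f′≢f σf′≡f′) (ι-mono i<f′) (ι-mono f′<j) (move-completes _ e avs)
    where
    avs : All (Avoids f) (add i f′ ∷ del i j ∷ [])
    avs = (proj₁ (avoids a) , ≢-sym f′≢f) ∷ avoids a ∷ []
  predecessor-lifts (right i j f′ a σf′≡f′ i<f′ f′<j e) with f′ ≟ f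
  ... | yes refl = right-into-f a i<f′ f′<j e
  ... | no f′≢f = f , move-fixes-f e avs ,
    right (ι i) (ι j) (ι f′) (σ̂-arc a) (complete-fixed f′≢f σf′≡f′) (ι-mono i<f′) (ι-mono f′<j) (move-completes _ e avs)
    where
    avs : All (Avoids f) (add f′ j ∷ del i j ∷ [])
    avs = (≢-sym f′≢f , proj₂ (avoids a)) ∷ avoids a ∷ []
  predecessor-lifts (cross-nest i j l m a b i<l l<j j<m e) = f , move-fixes-f e avs ,
    cross-nest (ι i) (ι j) (ι l) (ι m) (σ̂-arc a) (σ̂-arc b) (ι-mono i<l) (ι-mono l<j) (ι-mono j<m) (move-completes _ e avs)
    where
    avs : All (Avoids f) (add i l ∷ add j m ∷ del l m ∷ del i j ∷ [])
    avs = (proj₁ (avoids a) , proj₁ (avoids b)) ∷ (proj₂ (avoids a) , proj₂ (avoids b)) ∷ avoids b ∷ avoids a ∷ []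
  predecessor-lifts (cross-par i j l m a b i<l l<j j<m e) = f , move-fixes-f e avs ,
    cross-par (ι i) (ι j) (ι l) (ι m) (σ̂-arc a) (σ̂-arc b) (ι-mono i<l) (ι-mono l<j) (ι-mono j<m) (move-completes _ e avs)
    where
    avs : All (Avoids f) (add i m ∷ add j l ∷ del l m ∷ del i j ∷ [])
    avs = (proj₁ (avoids a) , proj₂ (avoids b)) ∷ (proj₂ (avoids a) , proj₁ (avoids b)) ∷ avoids b ∷ avoids a ∷ []

lemma16 : (n k : ℕ) (σ : LP n) → InI n k σ →
          (f : Fin n) → IsMaxFixed σ f →
          (σ' : LP n) → Pred σ σ' →
          Σ (Fin n) (λ g → Fixed σ' g ×
            Pred (addArc (inject₁ f) (lastPt n) (extend σ))
                 (addArc (inject₁ g) (lastPt n) (extend σ')))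
lemma16 n k σ (inv , _) f (σf≡f , _) σ' p = Completion.predecessor-lifts σ inv f σf≡f p
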